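{- The following are admissible in $\mathsf{C}(\ast,\mathrel{ -\!\!\ast})$ (for axiom schemata: every instance is derivable; for rules: whenever the premise is derivable, so is the conclusion), for arbitrary formulae $\varphi,\psi,\chi$ and program variables $x,y$: (i) $(\bot\mathrel{ -\!\!\circledast}\varphi)\Rightarrow\bot$; (ii) $(\varphi\mathrel{ -\!\!\circledast}\bot)\Rightarrow\bot$; (iii) $(\varphi\ast(\varphi\mathrel{ -\!\!\ast}\psi))\Rightarrow\psi$; (iv) from $\varphi\Rightarrow\psi$ infer $(\varphi\mathrel{ -\!\!\circledast}\chi)\Rightarrow(\psi\mathrel{ -\!\!\circledast}\chi)$; (v) from $\varphi\Rightarrow\psi$ infer $(\chi\mathrel{ -\!\!\circledast}\varphi)\Rightarrow(\chi\mathrel{ -\!\!\circledast}\psi)$; (vi) $(\varphi\mathrel{ -\!\!\circledast}(\psi\mathrel{ -\!\!\circledast}\chi))\Leftrightarrow((\varphi\ast\psi)\mathrel{ -\!\!\circledast}\chi)$; (vii) $((\varphi\vee\psi)\mathrel{ -\!\!\circledast}\chi)\Leftrightarrow((\varphi\mathrel{ -\!\!\circledast}\chi)\vee(\psi\mathrel{ -\!\!\circledast}\chi))$; (viii) $(\chi\mathrel{ -\!\!\circledast}(\varphi\vee\psi))\Leftrightarrow((\chi\mathrel{ -\!\!\circledast}\varphi)\vee(\chi\mathrel{ -\!\!\circledast}\psi))$; (ix) $((\varphi\mathrel{ -\!\!\circledast}\psi)\wedge(\varphi\mathrel{ -\!\!\ast}\chi))\Rightarrow(\varphi\mathrel{ -\!\!\circledast}(\psi\wedge\chi))$;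 (x) $(x=y\wedge(\varphi\mathrel{ -\!\!\circledast}\psi))\Rightarrow((\varphi\wedge x=y)\mathrel{ -\!\!\circledast}\psi)$; (xi) $(\neg(x=y)\wedge(\varphi\mathrel{ -\!\!\circledast}\psi))\Rightarrow((\varphi\wedge\neg(x=y))\mathrel{ -\!\!\circledast}\psi)$; (xii) $(\varphi_{\mathrm{size}}\wedge\bigwedge_{x\in X}\neg\mathrm{alloc}(x))\mathrel{ -\!\!\circledast}\top$, where $X\subseteq\mathrm{PVAR}$ is finite and $\varphi_{\mathrm{size}}$ is a satisfiable conjunction of literals of the form $\mathrm{size}\ge\beta_1$ or $\neg\,\mathrm{size}\ge\beta_2$.
   Context: Syntax of $\mathrm{SL}(\ast,\mathrel{ -\!\!\ast})$: fix a countably infinite set $\mathrm{PVAR}$ of program variables and a countably infinite set $\mathrm{LOC}$ of locations. Formulae: $\varphi ::= x = y \mid x \hookrightarrow y \mid \mathrm{emp} \mid \neg\varphi \mid \varphi\wedge\varphi \mid \varphi \ast \varphi \mid \varphi \mathrel{ -\!\!\ast} \varphi$ ($x,y\in\mathrm{PVAR}$). Memory states $(s,h)$ with $s:\mathrm{PVAR}\to\mathrm{LOC}$ and $h$ a partial function $\mathrm{LOC}\to\mathrm{LOC}$ with finite domain; $(s,h)\models\mathrm{emp}$ iff $\mathrm{dom}(h)=\emptyset$, $(s,h)\models \varphi_1\ast\varphi_2$ iff $h$ splits into two domain-disjoint heaps satisfying $\varphi_1$ and $\varphi_2$ respectively; a formula is satisfiable if some memory state satisfies it. Abbreviations: $\bot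 := \neg(x=x)$, $\top:=\neg\bot$; $\varphi \mathrel{ -\!\!\circledast} \psi := \neg(\varphi\mathrel{ -\!\!\ast}\neg\psi)$; $\mathrm{alloc}(x) := (x\hookrightarrow x)\mathrel{ -\!\!\ast}\bot$; $\mathrm{size}\ge 0 := \top$, $\mathrm{size}\ge 1 := \neg\mathrm{emp}$, $\mathrm{size}\ge\beta := \neg\mathrm{emp}\ast\mathrm{size}\ge\beta-1$ for $\beta\ge2$ (so $(s,h)\models\mathrm{size}\ge\beta$ iff $|\mathrm{dom}(h)|\ge\beta$); $\mathrm{size}=\beta := \mathrm{size}\ge\beta\wedge\neg\,\mathrm{size}\ge\beta+1$; $a\dot- b=\max(0,a-b)$. The system $\mathsf{C}(\ast,\mathrel{ -\!\!\ast})$ (derivability is the least set containing all instances of the axiom schemata, metavariables ranging over formulae, variables, naturals and finite sets $X\subseteq\mathrm{PVAR}$, and closed under the rules) contains all axiom schemata of classical propositional calculus and modus ponens, together with: (1) $x=x$; (2) $\varphi\wedge x=y\Rightarrow\varphi'$, where $\varphi'$ is obtained from $\varphi$ by replacing every occurrence of $y$ with $x$; (3) $x\hookrightarrow y\Rightarrow\mathrm{alloc}(x)$; (4) $(x\hookrightarrow y\wedge x\hookrightarrow z)\Rightarrow y=z$; (5) $(\varphi\ast\psi)\Leftrightarrow(\psi\ast\varphi)$; (6) $((\varphi\ast\psi)\ast\chi)\Leftrightarrow(\varphi\ast(\psi\ast\chi))$; (7) $\varphi\Leftrightarrow(\varphi\ast\mathrm{emp})$; (8) $(\mathrm{alloc}(x)\ast\mathrm{alloc}(x))\Leftrightarrow\bot$;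 (9) $(\xi\ast\top)\Rightarrow\xi$ for $\xi\in\{\neg\mathrm{emp},\ x=y,\ \neg(x=y),\ x\hookrightarrow y\}$; (10) $(\neg\mathrm{alloc}(x)\ast\neg\mathrm{alloc}(x))\Rightarrow\neg\mathrm{alloc}(x)$; (11) $((\mathrm{alloc}(x)\wedge\neg x\hookrightarrow y)\ast\top)\Rightarrow\neg x\hookrightarrow y$; (12) $\mathrm{alloc}(x)\Rightarrow((\mathrm{alloc}(x)\wedge\mathrm{size}=1)\ast\top)$; (13) $\neg\mathrm{emp}\Rightarrow(\mathrm{size}=1\ast\top)$; (14) $(\neg\,\mathrm{size}\ge\beta_1\ast\neg\,\mathrm{size}\ge\beta_2)\Rightarrow\neg\,\mathrm{size}\ge\beta_1+\beta_2\dot-1$; (15) $(\mathrm{alloc}(x)\wedge\mathrm{alloc}(y)\wedge\neg(x=y))\Rightarrow\mathrm{size}\ge2$; (16) $(\mathrm{size}=1\wedge\bigwedge_{x\in X}\neg\mathrm{alloc}(x))\mathrel{ -\!\!\circledast}\top$; (17) $\neg\mathrm{alloc}(x)\Rightarrow((x\hookrightarrow y\wedge\mathrm{size}=1)\mathrel{ -\!\!\circledast}\top)$; (18) $\neg\mathrm{alloc}(x)\Rightarrow((\mathrm{alloc}(x)\wedge\mathrm{size}=1\wedge\bigwedge_{y\in X}\neg x\hookrightarrow y)\mathrel{ -\!\!\circledast}\top)$; and the rules: from $\varphi\Rightarrow\chi$ infer $(\varphi\ast\psi)\Rightarrow(\chi\ast\psi)$; from $(\varphi\ast\psi)\Rightarrow\chi$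 infer $\varphi\Rightarrow(\psi\mathrel{ -\!\!\ast}\chi)$; from $\varphi\Rightarrow(\psi\mathrel{ -\!\!\ast}\chi)$ infer $(\varphi\ast\psi)\Rightarrow\chi$. -}

module Defs where

open import Data.Nat using (ℕ; zero; suc; _+_; _∸_; _≡ᵇ_)
open import Data.Bool using (Bool; true; false; not; _∧_; if_then_else_)
open import Data.Fin using (Fin)
open import Data.List using (List; []; _∷_; map)
open import Data.List.Membership.Propositional using (_∈_)
open import Data.Maybe using (Maybe; just; nothing)
open import Data.Product using (Σ; _×_; _,_)
open import Data.Sum using (_⊎_)
open import Data.Empty using (⊥)
open import Relation.Binary.PropositionalEquality using (_≡_; _≢_)

PVar : Set
PVar = ℕ

infix  9 _≐_ _↪_
infix  8 ~_
infixr 7 _&_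
infixr 6 _∨_
infixr 5 _∗_ _-∗_ _-⊛_
infixr 4 _⇒_
infix  3 _⇔_

data Form : Set where
  _≐_  : PVar → PVar → Form
  _↪_  : PVar → PVar → Form
  emp  : Form
  ~_   : Form → Form
  _&_  : Form → Form → Form
  _∗_  : Form → Form → Form
  _-∗_ : Form → Form → Form

_⇒_ : Form → Form → Form
φ ⇒ ψ = ~ (φ & ~ ψ)

_∨_ : Form → Form → Form
φ ∨ ψ = ~ (~ φ & ~ ψ)

_⇔_ : Form → Form → Form
φ ⇔ ψ = (φ ⇒ ψ) & (ψ ⇒ φ)

⊥' : Form
⊥' = ~ (0 ≐ 0)

⊤' : Form
⊤' = ~ ⊥'

_-⊛_ : Form → Form → Form
φ -⊛ ψ = ~ (φ -∗ ~ ψ)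

alloc : PVar → Form
alloc x = (x ↪ x) -∗ ⊥'

size≥ : ℕ → Form
size≥ zero = ⊤'
size≥ (suc zero) = ~ emp
size≥ (suc (suc β)) = ~ emp ∗ size≥ (suc β)

size≡ : ℕ → Form
size≡ β = size≥ β & ~ size≥ (suc β)

⋀ : List Form → Form
⋀ [] = ⊤'
⋀ (φ ∷ []) = φ
⋀ (φ ∷ ψ ∷ φs) = φ & ⋀ (ψ ∷ φs)

rv : PVar → PVar → PVar → PVar
rv x y z = if z ≡ᵇ y then x else z

_[_/_] : Form → PVar → PVar → Form
(a ≐ b) [ x / y ] = rv x y a ≐ rv x y b
(a ↪ b) [ x / y ] = rv x y a ↪ rv x y b
emp [ x / y ] = emp
(~ φ) [ x / y ] = ~ (φ [ x / y ])
(φ & ψ) [ x / y ] = (φ [ x / y ]) & (ψ [ x / y ])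
(φ ∗ ψ) [ x / y ] = (φ [ x / y ]) ∗ (ψ [ x / y ])
(φ -∗ ψ) [ x / y ] = (φ [ x / y ]) -∗ (ψ [ x / y ])

-- Classical propositional calculus: instances of tautologies
-- (propositional formulae over ¬ and ∧, matching the primitive connectives).

data PForm (n : ℕ) : Set where
  pvar : Fin n → PForm n
  pneg : PForm n → PForm n
  pand : PForm n → PForm n → PForm n

evalP : {n : ℕ} → (Fin n → Bool) → PForm n → Bool
evalP v (pvar i) = v i
evalP v (pneg p) = not (evalP v p)
evalP v (pand p q) = evalP v p ∧ evalP v q

Tautology : {n : ℕ} → PForm n → Set
Tautology {n} p = (v : Fin n → Bool) → evalP v p ≡ true

instP : {n : ℕ} → (Fin n → Form) → PForm n → Form
instP σ (pvar i) = σ i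
instP σ (pneg p) = ~ instP σ p
instP σ (pand p q) = instP σ p & instP σ q

infix 2 ⊢_

data ⊢_ : Form → Set where
  taut  : {n : ℕ} (p : PForm n) → Tautology p → (σ : Fin n → Form) → ⊢ instP σ p
  mp    : {φ ψ : Form} → ⊢ φ ⇒ ψ → ⊢ φ → ⊢ ψ
  ax1   : (x : PVar) → ⊢ x ≐ x
  ax2   : (φ : Form) (x y : PVar) → ⊢ (φ & x ≐ y) ⇒ (φ [ x / y ])
  ax3   : (x y : PVar) → ⊢ (x ↪ y) ⇒ alloc x
  ax4   : (x y z : PVar) → ⊢ ((x ↪ y) & (x ↪ z)) ⇒ (y ≐ z)
  ax5   : (φ ψ : Form) → ⊢ (φ ∗ ψ) ⇔ (ψ ∗ φ)
  ax6   : (φ ψ χ : Form) → ⊢ ((φ ∗ ψ) ∗ χ) ⇔ (φ ∗ (ψ ∗ χ))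
  ax7   : (φ : Form) → ⊢ φ ⇔ (φ ∗ emp)
  ax8   : (x : PVar) → ⊢ (alloc x ∗ alloc x) ⇔ ⊥'
  ax9a  : ⊢ (~ emp ∗ ⊤') ⇒ ~ emp
  ax9b  : (x y : PVar) → ⊢ ((x ≐ y) ∗ ⊤') ⇒ (x ≐ y)
  ax9c  : (x y : PVar) → ⊢ (~ (x ≐ y) ∗ ⊤') ⇒ ~ (x ≐ y)
  ax9d  : (x y : PVar) → ⊢ ((x ↪ y) ∗ ⊤') ⇒ (x ↪ y)
  ax10  : (x : PVar) → ⊢ (~ alloc x ∗ ~ alloc x) ⇒ ~ alloc x
  ax11  : (x y : PVar) → ⊢ ((alloc x & ~ (x ↪ y)) ∗ ⊤') ⇒ ~ (x ↪ y)
  ax12  : (x : PVar) → ⊢ alloc x ⇒ ((alloc x & size≡ 1) ∗ ⊤')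
  ax13  : ⊢ ~ emp ⇒ (size≡ 1 ∗ ⊤')
  ax14  : (β₁ β₂ : ℕ) → ⊢ (~ size≥ β₁ ∗ ~ size≥ β₂) ⇒ ~ size≥ (β₁ + β₂ ∸ 1)
  ax15  : (x y : PVar) → ⊢ (alloc x & alloc y & ~ (x ≐ y)) ⇒ size≥ 2
  ax16  : (X : List PVar) → ⊢ (size≡ 1 & ⋀ (map (λ x → ~ alloc x) X)) -⊛ ⊤'
  ax17  : (x y : PVar) → ⊢ ~ alloc x ⇒ (((x ↪ y) & size≡ 1) -⊛ ⊤')
  ax18  : (x : PVar) (X : List PVar) →
          ⊢ ~ alloc x ⇒ ((alloc x & size≡ 1 & ⋀ (map (λ y → ~ (x ↪ y)) X)) -⊛ ⊤')
  r∗    : {φ χ : Form} (ψ : Form) → ⊢ φ ⇒ χ → ⊢ (φ ∗ ψ) ⇒ (χ ∗ ψ)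
  curry   : {φ ψ χ : Form} → ⊢ (φ ∗ ψ) ⇒ χ → ⊢ φ ⇒ (ψ -∗ χ)
  uncurry : {φ ψ χ : Form} → ⊢ φ ⇒ (ψ -∗ χ) → ⊢ (φ ∗ ψ) ⇒ χ

-- Semantics (needed for "satisfiable" in (xii)).  LOC = ℕ.

Loc : Set
Loc = ℕ

Store : Set
Store = PVar → Loc

record Heap : Set where
  constructor heap
  field
    at     : Loc → Maybe Loc
    finite : Σ (List Loc) λ L → (l : Loc) → at l ≢ nothing → l ∈ L
open Heap public

Split : Heap → Heap → Heap → Set
Split h h₁ h₂ = (l : Loc) →
  (at h l ≡ at h₁ l × at h₂ l ≡ nothing) ⊎ (at h l ≡ at h₂ l × at h₁ l ≡ nothing)

_,_⊨_ : Store → Heap → Form → Set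
s , h ⊨ (x ≐ y) = s x ≡ s y
s , h ⊨ (x ↪ y) = at h (s x) ≡ just (s y)
s , h ⊨ emp = (l : Loc) → at h l ≡ nothing
s , h ⊨ (~ φ) = s , h ⊨ φ → ⊥
s , h ⊨ (φ & ψ) = (s , h ⊨ φ) × (s , h ⊨ ψ)
s , h ⊨ (φ ∗ ψ) = Σ Heap λ h₁ → Σ Heap λ h₂ → Split h h₁ h₂ × (s , h₁ ⊨ φ) × (s , h₂ ⊨ ψ)
s , h ⊨ (φ -∗ ψ) = (h' h'' : Heap) → Split h'' h h' → s , h' ⊨ φ → s , h'' ⊨ ψ

Satisfiable : Form → Set
Satisfiable φ = Σ Store λ s → Σ Heap λ h → s , h ⊨ φ

data SizeLit : Set where
  atLeast    : ℕ → SizeLit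
  notAtLeast : ℕ → SizeLit

litForm : SizeLit → Form
litForm (atLeast β) = size≥ β
litForm (notAtLeast β) = ~ size≥ β

sizeConj : List SizeLit → Form
sizeConj L = ⋀ (map litForm L)

-- Everything is a syntactic derivation in C(∗,-∗), except one semantic
-- argument needed to exploit the satisfiability hypothesis of item (xii).
--
--  * A decision procedure for propositional tautologies (enumeration of all
--    valuations) lets the propositional-calculus axiom produce any needed
--    classical reasoning step; on top of it a small propositional kit.
--  * A separation kit: monotonicity of ∗, commutativity, elimination of
--    the magic wand, distribution of ∗ over ∨, (un)currying of -∗.
--  * Items (i)-(xi) are general laws of septraction φ -⊛ ψ = ¬(φ -∗ ¬ψ);
--    (x) and (xi) are instances of one law for "pure" formulas, i.e.
--    formulas that absorb ⊤ under ∗ both positively and negatively.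
--  * Item (xii): by induction on n, (size = n ∧ no x ∈ X allocated) -⊛ ⊤
--    is derivable (base case from emp, step from axioms (14) and (16)).
--    A model of the size literals has at least n heap cells, n the largest
--    lower bound β₁; then n < β₂ for every upper literal, so size = n
--    derivably implies the whole conjunction, and monotonicity concludes.
module Submission where

open import Defs
open import Data.Bool using (Bool; true; false; T; _∧_; not)
open import Data.Bool.Properties using (T-∧; T-≡)
open import Data.Fin using (Fin; zero; suc)
open import Data.List using (List; []; _∷_; map)
open import Data.List.Relation.Unary.All using (All; []; _∷_; universal)
import Data.List.Relation.Unary.All as All
open import Data.List.Relation.Unary.All.Properties using (map⁺; map⁻)
open import Data.Nat using (ℕ; zero; suc; _≤_; _<_; _≤′_; ≤′-reflexive; ≤′-step; _⊔_; _<?_)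
open import Data.Nat.Properties using (≤⇒≤′; ≮⇒≥; ≤-refl; ⊔-sel; m⊔n≤o⇒m≤o; m⊔n≤o⇒n≤o)
open import Data.Product using (_×_; _,_; proj₁; proj₂)
open import Data.Sum using (inj₁; inj₂)
open import Data.Vec using (Vec; []; _∷_; lookup)
open import Data.Empty using (⊥-elim)
open import Function using (_∘_)
open import Function.Bundles using (Equivalence)
open import Relation.Nullary using (yes; no)
open import Relation.Binary.PropositionalEquality using (_≡_; refl; sym; trans; cong; subst)

extend : ∀ {n} → Bool → (Fin n → Bool) → Fin (suc n) → Bool
extend b v zero = b
extend b v (suc i) = v i

extend-head-tail : ∀ {n} (v : Fin (suc n) → Bool) (i : Fin (suc n)) →
                   extend (v zero) (v ∘ suc) i ≡ v i
extend-head-tail v zero = refl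
extend-head-tail v (suc i) = refl

Extensional : ∀ {n} → ((Fin n → Bool) → Bool) → Set
Extensional f = ∀ v w → (∀ i → v i ≡ w i) → f v ≡ f w

extend-extensional : ∀ {n} (f : (Fin (suc n) → Bool) → Bool) (b : Bool) →
                     Extensional f → Extensional (f ∘ extend b)
extend-extensional f b ext v w v≗w = ext _ _ pointwise
  where pointwise : ∀ i → extend b v i ≡ extend b w i
        pointwise zero = refl
        pointwise (suc i) = v≗w i

holdsForAll : (n : ℕ) → ((Fin n → Bool) → Bool) → Bool
holdsForAll zero f = f (λ ())
holdsForAll (suc n) f = holdsForAll n (f ∘ extend true) ∧ holdsForAll n (f ∘ extend false)

holdsForAll-sound : ∀ n f → Extensional f → T (holdsForAll n f) → ∀ v → T (f v)
holdsForAll-sound zero f ext ok v = subst T (ext _ v (λ ())) ok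
holdsForAll-sound (suc n) f ext ok v =
  subst T (ext _ v (extend-head-tail v)) (byHead (v zero))
  where
    both = Equivalence.to T-∧ ok
    byHead : ∀ b → T (f (extend b (v ∘ suc)))
    byHead true  = holdsForAll-sound n _ (extend-extensional f true ext) (proj₁ both) (v ∘ suc)
    byHead false = holdsForAll-sound n _ (extend-extensional f false ext) (proj₂ both) (v ∘ suc)

evalP-extensional : ∀ {n} (p : PForm n) → Extensional (λ v → evalP v p)
evalP-extensional (pvar i) v w v≗w = v≗w i
evalP-extensional (pneg p) v w v≗w = cong not (evalP-extensional p v w v≗w)
evalP-extensional (pand p q) v w v≗w =
  cong₂∧ (evalP-extensional p v w v≗w) (evalP-extensional q v w v≗w)
  where cong₂∧ : ∀ {a b c d} → a ≡ b → c ≡ d → a ∧ c ≡ b ∧ d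
        cong₂∧ refl refl = refl

valid : ∀ {n} → PForm n → Bool
valid {n} p = holdsForAll n (λ v → evalP v p)

tautology : ∀ {n} (σ : Vec Form n) (p : PForm n) {_ : T (valid p)} → ⊢ instP (lookup σ) p
tautology σ p {ok} =
  taut p (λ v → Equivalence.to T-≡ (holdsForAll-sound _ _ (evalP-extensional p) ok v)) (lookup σ)

infixr 4 _⊃_
infixr 5 _∨ₚ_
infixr 6 _∧ₚ_

_⊃_ _∧ₚ_ _∨ₚ_ : ∀ {n} → PForm n → PForm n → PForm n
p ⊃ q = pneg (pand p (pneg q))
p ∧ₚ q = pand p q
p ∨ₚ q = pneg (pand (pneg p) (pneg q))

¬ₚ : ∀ {n} → PForm n → PForm n
¬ₚ = pneg

p₀ : ∀ {n} → PForm (suc n)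
p₀ = pvar zero

p₁ : ∀ {n} → PForm (suc (suc n))
p₁ = pvar (suc zero)

p₂ : ∀ {n} → PForm (suc (suc (suc n)))
p₂ = pvar (suc (suc zero))

variable A B C D E : Form

infixr 3 _⨾_

mp₂ : ⊢ A ⇒ B ⇒ C → ⊢ A → ⊢ B → ⊢ C
mp₂ t a b = mp (mp t a) b

⇒-refl : ⊢ A ⇒ A
⇒-refl {A} = tautology (A ∷ []) (p₀ ⊃ p₀)

_⨾_ : ⊢ A ⇒ B → ⊢ B ⇒ C → ⊢ A ⇒ C
_⨾_ {A} {B} {C} = mp₂ (tautology (A ∷ B ∷ C ∷ []) ((p₀ ⊃ p₁) ⊃ (p₁ ⊃ p₂) ⊃ (p₀ ⊃ p₂)))

&-intro : ⊢ A → ⊢ B → ⊢ A & B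
&-intro {A} {B} = mp₂ (tautology (A ∷ B ∷ []) (p₀ ⊃ p₁ ⊃ (p₀ ∧ₚ p₁)))

&-elimˡ : ⊢ (A & B) ⇒ A
&-elimˡ {A} {B} = tautology (A ∷ B ∷ []) ((p₀ ∧ₚ p₁) ⊃ p₀)

&-elimʳ : ⊢ (A & B) ⇒ B
&-elimʳ {A} {B} = tautology (A ∷ B ∷ []) ((p₀ ∧ₚ p₁) ⊃ p₁)

⇒-& : ⊢ A ⇒ B → ⊢ A ⇒ C → ⊢ A ⇒ (B & C)
⇒-& {A} {B} {C} = mp₂ (tautology (A ∷ B ∷ C ∷ []) ((p₀ ⊃ p₁) ⊃ (p₀ ⊃ p₂) ⊃ (p₀ ⊃ (p₁ ∧ₚ p₂))))

&-mono : ⊢ A ⇒ B → ⊢ C ⇒ D → ⊢ (A & C) ⇒ (B & D)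
&-mono f g = ⇒-& (&-elimˡ ⨾ f) (&-elimʳ ⨾ g)

∨-introˡ : ⊢ A ⇒ (A ∨ B)
∨-introˡ {A} {B} = tautology (A ∷ B ∷ []) (p₀ ⊃ (p₀ ∨ₚ p₁))

∨-introʳ : ⊢ B ⇒ (A ∨ B)
∨-introʳ {B} {A} = tautology (A ∷ B ∷ []) (p₁ ⊃ (p₀ ∨ₚ p₁))

∨-elim : ⊢ A ⇒ C → ⊢ B ⇒ C → ⊢ (A ∨ B) ⇒ C
∨-elim {A} {C} {B} = mp₂ (tautology (A ∷ B ∷ C ∷ []) ((p₀ ⊃ p₂) ⊃ (p₁ ⊃ p₂) ⊃ ((p₀ ∨ₚ p₁) ⊃ p₂)))

contrapose : ⊢ A ⇒ B → ⊢ ~ B ⇒ ~ A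
contrapose {A} {B} = mp (tautology (A ∷ B ∷ []) ((p₀ ⊃ p₁) ⊃ (¬ₚ p₁ ⊃ ¬ₚ p₀)))

⇒-const : ⊢ B → ⊢ A ⇒ B
⇒-const {B} {A} = mp (tautology (A ∷ B ∷ []) (p₁ ⊃ (p₀ ⊃ p₁)))

¬¬-intro : ⊢ A ⇒ ~ ~ A
¬¬-intro {A} = tautology (A ∷ []) (p₀ ⊃ ¬ₚ (¬ₚ p₀))

¬¬-elim : ⊢ ~ ~ A ⇒ A
¬¬-elim {A} = tautology (A ∷ []) (¬ₚ (¬ₚ p₀) ⊃ p₀)

⇔-to : ⊢ A ⇔ B → ⊢ A ⇒ B
⇔-to = mp &-elimˡ

⇔-from : ⊢ A ⇔ B → ⊢ B ⇒ A
⇔-from = mp &-elimʳ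

⊤-intro : ⊢ ⊤'
⊤-intro = mp ¬¬-intro (ax1 0)

⇒⊤ : ⊢ A ⇒ ⊤'
⇒⊤ = ⇒-const ⊤-intro

⊥⇒ : ⊢ ⊥' ⇒ A
⊥⇒ {A} = mp (tautology ((0 ≐ 0) ∷ A ∷ []) (p₀ ⊃ (¬ₚ p₀ ⊃ p₁))) (ax1 0)

~-cong : ⊢ A ⇒ B → ⊢ B ⇒ A → ⊢ (~ A) ⇔ (~ B)
~-cong f g = &-intro (contrapose g) (contrapose f)

~-of-& : ⊢ A ⇒ (B & C) → ⊢ (B & C) ⇒ A → ⊢ (~ A) ⇔ ((~ B) ∨ (~ C))
~-of-& {A} {B} {C} = mp₂ (tautology (A ∷ B ∷ C ∷ [])
  ((p₀ ⊃ (p₁ ∧ₚ p₂)) ⊃ ((p₁ ∧ₚ p₂) ⊃ p₀) ⊃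
     ((¬ₚ p₀ ⊃ (¬ₚ p₁ ∨ₚ ¬ₚ p₂)) ∧ₚ ((¬ₚ p₁ ∨ₚ ¬ₚ p₂) ⊃ ¬ₚ p₀))))

∗-comm : ⊢ (A ∗ B) ⇒ (B ∗ A)
∗-comm {A} {B} = ⇔-to (ax5 A B)

∗-monoˡ : ⊢ A ⇒ B → ⊢ (A ∗ C) ⇒ (B ∗ C)
∗-monoˡ {C = C} = r∗ C

∗-monoʳ : ⊢ A ⇒ B → ⊢ (C ∗ A) ⇒ (C ∗ B)
∗-monoʳ f = ∗-comm ⨾ ∗-monoˡ f ⨾ ∗-comm

∗-mono : ⊢ A ⇒ B → ⊢ C ⇒ D → ⊢ (A ∗ C) ⇒ (B ∗ D)
∗-mono f g = ∗-monoˡ f ⨾ ∗-monoʳ g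

∗-&-split : ⊢ ((A & B) ∗ (C & D)) ⇒ ((A ∗ C) & (B ∗ D))
∗-&-split = ⇒-& (∗-mono &-elimˡ &-elimˡ) (∗-mono &-elimʳ &-elimʳ)

-- ∗ distributes over ∨ (via the adjunction between ∗ and -∗).
∗-∨-distrib : ⊢ ((A ∨ B) ∗ C) ⇒ ((A ∗ C) ∨ (B ∗ C))
∗-∨-distrib = uncurry (∨-elim (curry ∨-introˡ) (curry ∨-introʳ))

wand-elim : ⊢ ((A -∗ B) ∗ A) ⇒ B
wand-elim = uncurry ⇒-refl

wand-&-elim : ⊢ (((A -∗ B) & (A -∗ C)) ∗ A) ⇒ (B & C)
wand-&-elim = ⇒-& (∗-monoˡ &-elimˡ ⨾ wand-elim) (∗-monoˡ &-elimʳ ⨾ wand-elim)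

wand-monoʳ : ⊢ B ⇒ C → ⊢ (A -∗ B) ⇒ (A -∗ C)
wand-monoʳ f = curry (wand-elim ⨾ f)

wand-antiˡ : ⊢ B ⇒ A → ⊢ (A -∗ C) ⇒ (B -∗ C)
wand-antiˡ f = curry (∗-monoʳ f ⨾ wand-elim)

wand-uncurry : ⊢ (A -∗ (B -∗ C)) ⇒ ((A ∗ B) -∗ C)
wand-uncurry {A} {B} = curry (⇔-from (ax6 _ A B) ⨾ uncurry wand-elim)

wand-curry : ⊢ ((A ∗ B) -∗ C) ⇒ (A -∗ (B -∗ C))
wand-curry {A = A} {B} = curry (curry (⇔-to (ax6 _ A B) ⨾ wand-elim))

septract-refuted : ⊢ A -∗ ~ B → ⊢ (A -⊛ B) ⇒ ⊥'
septract-refuted {A} {B} = mp (tautology ((A -∗ ~ B) ∷ ⊥' ∷ []) (p₀ ⊃ (¬ₚ p₀ ⊃ p₁)))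

septract-⊥ˡ : (φ : Form) → ⊢ (⊥' -⊛ φ) ⇒ ⊥'
septract-⊥ˡ φ = septract-refuted (mp (curry (∗-comm ⨾ uncurry ⊥⇒)) ⊤-intro)

septract-⊥ʳ : (φ : Form) → ⊢ (φ -⊛ ⊥') ⇒ ⊥'
septract-⊥ʳ φ = septract-refuted (mp (curry ⇒⊤) ⊤-intro)

∗-wand-elim : (φ ψ : Form) → ⊢ (φ ∗ (φ -∗ ψ)) ⇒ ψ
∗-wand-elim φ ψ = ∗-comm ⨾ wand-elim

septract-monoˡ : (φ ψ χ : Form) → ⊢ φ ⇒ ψ → ⊢ (φ -⊛ χ) ⇒ (ψ -⊛ χ)
septract-monoˡ φ ψ χ f = contrapose (wand-antiˡ f)

septract-monoʳ : (φ ψ χ : Form) → ⊢ φ ⇒ ψ → ⊢ (χ -⊛ φ) ⇒ (χ -⊛ ψ)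
septract-monoʳ φ ψ χ f = contrapose (wand-monoʳ (contrapose f))

septract-∗ : (φ ψ χ : Form) → ⊢ (φ -⊛ (ψ -⊛ χ)) ⇔ ((φ ∗ ψ) -⊛ χ)
septract-∗ φ ψ χ = ~-cong (wand-monoʳ ¬¬-elim ⨾ wand-uncurry) (wand-curry ⨾ wand-monoʳ ¬¬-intro)

septract-∨ˡ : (φ ψ χ : Form) → ⊢ ((φ ∨ ψ) -⊛ χ) ⇔ ((φ -⊛ χ) ∨ (ψ -⊛ χ))
septract-∨ˡ φ ψ χ = ~-of-& (⇒-& (wand-antiˡ ∨-introˡ) (wand-antiˡ ∨-introʳ)) (curry byCases)
  where
    byCases : ⊢ (((φ -∗ ~ χ) & (ψ -∗ ~ χ)) ∗ (φ ∨ ψ)) ⇒ ~ χ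
    byCases = ∗-comm ⨾ ∗-∨-distrib ⨾ ∨-elim (∗-comm ⨾ ∗-monoˡ &-elimˡ ⨾ wand-elim)
                                            (∗-comm ⨾ ∗-monoˡ &-elimʳ ⨾ wand-elim)

septract-∨ʳ : (φ ψ χ : Form) → ⊢ (χ -⊛ (φ ∨ ψ)) ⇔ ((χ -⊛ φ) ∨ (χ -⊛ ψ))
septract-∨ʳ φ ψ χ =
  ~-of-& (⇒-& (wand-monoʳ (contrapose ∨-introˡ)) (wand-monoʳ (contrapose ∨-introʳ)))
         (curry (wand-&-elim ⨾ tautology (φ ∷ ψ ∷ []) ((¬ₚ p₀ ∧ₚ ¬ₚ p₁) ⊃ ¬ₚ (p₀ ∨ₚ p₁))))

septract-&-wand : (φ ψ χ : Form) → ⊢ ((φ -⊛ ψ) & (φ -∗ χ)) ⇒ (φ -⊛ (ψ & χ))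
septract-&-wand φ ψ χ =
  mp (tautology ((φ -∗ ~ ψ) ∷ (φ -∗ χ) ∷ (φ -∗ ~ (ψ & χ)) ∷ [])
       (((p₁ ∧ₚ p₂) ⊃ p₀) ⊃ ((¬ₚ p₀ ∧ₚ p₁) ⊃ ¬ₚ p₂)))
     (curry (wand-&-elim ⨾ tautology (ψ ∷ χ ∷ []) ((p₁ ∧ₚ ¬ₚ (p₀ ∧ₚ p₁)) ⊃ ¬ₚ p₀)))

-- A formula is pure when it absorbs ⊤ under ∗, both as itself and negated,
-- i.e. its truth value passes from a subheap to the whole heap.
record Pure (E : Form) : Set where
  field
    absorb  : ⊢ (E ∗ ⊤') ⇒ E
    absorb~ : ⊢ (~ E ∗ ⊤') ⇒ ~ E
open Pure

Pure-≐ : (x y : PVar) → Pure (x ≐ y)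
Pure-≐ x y = record { absorb = ax9b x y ; absorb~ = ax9c x y }

Pure-~ : Pure E → Pure (~ E)
Pure-~ pure = record { absorb = absorb~ pure ; absorb~ = ∗-monoˡ ¬¬-elim ⨾ absorb pure ⨾ ¬¬-intro }

-- Under a pure E, a wand guarded by E may drop the guard: the argument heap
-- either satisfies E, or satisfies ¬E, which then contradicts E globally.
wand-pure : Pure E → (φ C : Form) → ⊢ (E & ((φ & E) -∗ C)) ⇒ (φ -∗ C)
wand-pure {E} pure φ C =
  curry (⇒-& holdsE (∗-monoˡ &-elimʳ ⨾ byCases) ⨾ tautology (E ∷ C ∷ []) ((p₀ ∧ₚ (p₁ ∨ₚ ¬ₚ p₀)) ⊃ p₁))
  where
    holdsE : ⊢ ((E & ((φ & E) -∗ C)) ∗ φ) ⇒ E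
    holdsE = ∗-mono &-elimˡ ⇒⊤ ⨾ absorb pure
    splitByE : ⊢ φ ⇒ ((φ & E) ∨ (φ & ~ E))
    splitByE = tautology (φ ∷ E ∷ []) (p₀ ⊃ ((p₀ ∧ₚ p₁) ∨ₚ (p₀ ∧ₚ ¬ₚ p₁)))
    byCases : ⊢ (((φ & E) -∗ C) ∗ φ) ⇒ (C ∨ ~ E)
    byCases = ∗-monoʳ splitByE ⨾ ∗-comm ⨾ ∗-∨-distrib
            ⨾ ∨-elim (∗-comm ⨾ wand-elim ⨾ ∨-introˡ) (∗-mono &-elimʳ ⇒⊤ ⨾ absorb~ pure ⨾ ∨-introʳ)

septract-pure : Pure E → (φ ψ : Form) → ⊢ (E & (φ -⊛ ψ)) ⇒ ((φ & E) -⊛ ψ)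
septract-pure {E} pure φ ψ =
  mp (tautology (E ∷ ((φ & E) -∗ ~ ψ) ∷ (φ -∗ ~ ψ) ∷ [])
       (((p₀ ∧ₚ p₁) ⊃ p₂) ⊃ ((p₀ ∧ₚ ¬ₚ p₂) ⊃ ¬ₚ p₁)))
     (wand-pure pure φ (~ ψ))

⋀-intro : {Φ : List Form} → All (λ φ → ⊢ A ⇒ φ) Φ → ⊢ A ⇒ ⋀ Φ
⋀-intro [] = ⇒⊤
⋀-intro (f ∷ []) = f
⋀-intro (f ∷ g ∷ gs) = ⇒-& f (⋀-intro (g ∷ gs))

⋀-∗-idem : {Φ : List Form} → All (λ φ → ⊢ (φ ∗ φ) ⇒ φ) Φ → ⊢ (⋀ Φ ∗ ⋀ Φ) ⇒ ⋀ Φ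
⋀-∗-idem [] = ⇒⊤
⋀-∗-idem (f ∷ []) = f
⋀-∗-idem (f ∷ g ∷ gs) = ⇒-& (∗-mono &-elimˡ &-elimˡ ⨾ f) (∗-mono &-elimʳ &-elimʳ ⨾ ⋀-∗-idem (g ∷ gs))

Unallocated : List PVar → Form
Unallocated X = ⋀ (map (λ x → ~ alloc x) X)

alloc⇒¬emp : (x : PVar) → ⊢ alloc x ⇒ ~ emp
alloc⇒¬emp x = ax12 x ⨾ ∗-monoˡ (&-elimʳ ⨾ &-elimˡ) ⨾ ax9a

emp⇒Unallocated : (X : List PVar) → ⊢ emp ⇒ Unallocated X
emp⇒Unallocated X = ⋀-intro (map⁺ (universal (λ x → ¬¬-intro ⨾ contrapose (alloc⇒¬emp x)) X))

Unallocated-∗ : (X : List PVar) → ⊢ (Unallocated X ∗ Unallocated X) ⇒ Unallocated X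
Unallocated-∗ X = ⋀-∗-idem (map⁺ (universal ax10 X))

size≥-suc : ∀ n → ⊢ (~ emp ∗ size≥ n) ⇒ size≥ (suc n)
size≥-suc zero = ax9a
size≥-suc (suc n) = ⇒-refl

size≥-step : ∀ n → ⊢ size≥ (suc n) ⇒ size≥ n
size≥-step zero = ⇒⊤
size≥-step (suc zero) = ∗-monoʳ ⇒⊤ ⨾ ax9a
size≥-step (suc (suc n)) = ∗-monoʳ (size≥-step (suc n))

size≥-anti : ∀ {b n} → b ≤ n → ⊢ size≥ n ⇒ size≥ b
size≥-anti b≤n = go (≤⇒≤′ b≤n)
  where go : ∀ {b n} → b ≤′ n → ⊢ size≥ n ⇒ size≥ b
        go (≤′-reflexive refl) = ⇒-refl
        go (≤′-step b≤′n) = size≥-step _ ⨾ go b≤′n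

size≡-∗ : ∀ n → ⊢ (size≡ n ∗ size≡ 1) ⇒ size≡ (suc n)
size≡-∗ n = ∗-&-split ⨾ &-mono (∗-comm ⨾ size≥-suc n) (∗-comm ⨾ ax14 2 (suc n))

emp-septract : ⊢ emp ⇒ A → ⊢ A -⊛ ⊤'
emp-septract {A} e = mp₂ (tautology (W ∷ ⊤' ∷ []) ((p₀ ⊃ ¬ₚ p₁) ⊃ (p₁ ⊃ ¬ₚ p₀))) refuteW ⊤-intro
  where
    W = A -∗ ~ ⊤'
    refuteW : ⊢ W ⇒ ~ ⊤'
    refuteW = ⇔-to (ax7 W) ⨾ ∗-monoʳ e ⨾ wand-elim

septract-⊤-∗ : ⊢ A -⊛ ⊤' → ⊢ B -⊛ ⊤' → ⊢ (A ∗ B) -⊛ ⊤'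
septract-⊤-∗ {A} {B} a b =
  mp (⇔-to (septract-∗ A B ⊤')) (mp (septract-monoʳ ⊤' (B -⊛ ⊤') A (⇒-const b)) a)

septract-size≡ : ∀ n X → ⊢ (size≡ n & Unallocated X) -⊛ ⊤'
septract-size≡ zero X = emp-septract (⇒-& (⇒-& ⇒⊤ ¬¬-intro) (emp⇒Unallocated X))
septract-size≡ (suc n) X =
  mp (septract-monoˡ _ _ ⊤' (∗-&-split ⨾ &-mono (size≡-∗ n) (Unallocated-∗ X)))
     (septract-⊤-∗ (septract-size≡ n X) (ax16 X))

Admits : ℕ → SizeLit → Set
Admits n (atLeast β) = β ≤ n
Admits n (notAtLeast β) = n < β

size≡⇒literal : ∀ n l → Admits n l → ⊢ size≡ n ⇒ litForm l
size≡⇒literal n (atLeast β) β≤n = &-elimˡ ⨾ size≥-anti β≤n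
size≡⇒literal n (notAtLeast β) n<β = &-elimʳ ⨾ contrapose (size≥-anti n<β)

size≡⇒sizeConj : ∀ {n} {L : List SizeLit} → All (Admits n) L → ⊢ size≡ n ⇒ sizeConj L
size≡⇒sizeConj {n} admitted = ⋀-intro (map⁺ (All.map (λ {l} → size≡⇒literal n l) admitted))

lowerBound : List SizeLit → ℕ
lowerBound [] = 0
lowerBound (atLeast β ∷ L) = β ⊔ lowerBound L
lowerBound (notAtLeast β ∷ L) = lowerBound L

-- Semantics: in a model of the literals, size = lowerBound L is admitted.
module Models (s : Store) where

  ⊨⋀ : ∀ h {Φ} → s , h ⊨ ⋀ Φ → All (λ φ → s , h ⊨ φ) Φ
  ⊨⋀ h {[]} _ = []
  ⊨⋀ h {φ ∷ []} h⊨φ = h⊨φ ∷ []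
  ⊨⋀ h {φ ∷ ψ ∷ Φ} (h⊨φ , h⊨Φ) = h⊨φ ∷ ⊨⋀ h h⊨Φ

  emp-part : ∀ h h₁ h₂ → Split h h₁ h₂ → s , h ⊨ emp → s , h₁ ⊨ emp
  emp-part h h₁ h₂ split h⊨emp l with split l
  ... | inj₁ (h≡h₁ , _) = trans (sym h≡h₁) (h⊨emp l)
  ... | inj₂ (_ , h₁≡nothing) = h₁≡nothing

  ⊨size≥-step : ∀ h n → s , h ⊨ size≥ (suc n) → s , h ⊨ size≥ n
  ⊨size≥-step h zero _ h⊨⊥ = h⊨⊥ refl
  ⊨size≥-step h (suc zero) (h₁ , h₂ , split , h₁≠emp , _) h⊨emp =
    h₁≠emp (emp-part h h₁ h₂ split h⊨emp)
  ⊨size≥-step h (suc (suc n)) (h₁ , h₂ , split , h₁≠emp , h₂⊨) =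
    h₁ , h₂ , split , h₁≠emp , ⊨size≥-step h₂ (suc n) h₂⊨

  ⊨size≥-anti : ∀ h {b n} → b ≤ n → s , h ⊨ size≥ n → s , h ⊨ size≥ b
  ⊨size≥-anti h b≤n = go (≤⇒≤′ b≤n)
    where go : ∀ {b n} → b ≤′ n → s , h ⊨ size≥ n → s , h ⊨ size≥ b
          go (≤′-reflexive refl) h⊨ = h⊨
          go (≤′-step b≤′n) h⊨ = go b≤′n (⊨size≥-step h _ h⊨)

  ⊨lowerBound : ∀ h L → All (λ l → s , h ⊨ litForm l) L → s , h ⊨ size≥ (lowerBound L)
  ⊨lowerBound h [] _ h⊨⊥ = h⊨⊥ refl
  ⊨lowerBound h (atLeast β ∷ L) (h⊨β ∷ h⊨L) with ⊔-sel β (lowerBound L)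
  ... | inj₁ eq = subst (λ k → s , h ⊨ size≥ k) (sym eq) h⊨β
  ... | inj₂ eq = subst (λ k → s , h ⊨ size≥ k) (sym eq) (⊨lowerBound h L h⊨L)
  ⊨lowerBound h (notAtLeast β ∷ L) (_ ∷ h⊨L) = ⊨lowerBound h L h⊨L

  admits : ∀ h m L → lowerBound L ≤ m → s , h ⊨ size≥ m →
           All (λ l → s , h ⊨ litForm l) L → All (Admits m) L
  admits h m [] _ _ _ = []
  admits h m (atLeast β ∷ L) bound≤m h⊨m (_ ∷ h⊨L) =
    m⊔n≤o⇒m≤o β (lowerBound L) bound≤m
    ∷ admits h m L (m⊔n≤o⇒n≤o β (lowerBound L) bound≤m) h⊨m h⊨L
  admits h m (notAtLeast β ∷ L) bound≤m h⊨m (h⊭β ∷ h⊨L) with m <? β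
  ... | yes m<β = m<β ∷ admits h m L bound≤m h⊨m h⊨L
  ... | no m≮β = ⊥-elim (h⊭β (⊨size≥-anti h (≮⇒≥ m≮β) h⊨m))

septract-sizeConj : (L : List SizeLit) (X : List PVar) → Satisfiable (sizeConj L) →
                    ⊢ (sizeConj L & ⋀ (map (λ x → ~ alloc x) X)) -⊛ ⊤'
septract-sizeConj L X (s , h , h⊨L) =
  mp (septract-monoˡ _ _ ⊤' (&-mono (size≡⇒sizeConj admitted) ⇒-refl)) (septract-size≡ n X)
  where
    open Models s
    literals = map⁻ (⊨⋀ h h⊨L)
    n = lowerBound L
    admitted = admits h n L ≤-refl (⊨lowerBound h L literals) literals

lemma6p3 : ((φ : Form) → ⊢ (⊥' -⊛ φ) ⇒ ⊥')
    × ((φ : Form) → ⊢ (φ -⊛ ⊥') ⇒ ⊥')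
    × ((φ ψ : Form) → ⊢ (φ ∗ (φ -∗ ψ)) ⇒ ψ)
    × ((φ ψ χ : Form) → ⊢ φ ⇒ ψ → ⊢ (φ -⊛ χ) ⇒ (ψ -⊛ χ))
    × ((φ ψ χ : Form) → ⊢ φ ⇒ ψ → ⊢ (χ -⊛ φ) ⇒ (χ -⊛ ψ))
    × ((φ ψ χ : Form) → ⊢ (φ -⊛ (ψ -⊛ χ)) ⇔ ((φ ∗ ψ) -⊛ χ))
    × ((φ ψ χ : Form) → ⊢ ((φ ∨ ψ) -⊛ χ) ⇔ ((φ -⊛ χ) ∨ (ψ -⊛ χ)))
    × ((φ ψ χ : Form) → ⊢ (χ -⊛ (φ ∨ ψ)) ⇔ ((χ -⊛ φ) ∨ (χ -⊛ ψ)))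
    × ((φ ψ χ : Form) → ⊢ ((φ -⊛ ψ) & (φ -∗ χ)) ⇒ (φ -⊛ (ψ & χ)))
    × ((φ ψ : Form) (x y : PVar) → ⊢ ((x ≐ y) & (φ -⊛ ψ)) ⇒ ((φ & (x ≐ y)) -⊛ ψ))
    × ((φ ψ : Form) (x y : PVar) → ⊢ (~ (x ≐ y) & (φ -⊛ ψ)) ⇒ ((φ & ~ (x ≐ y)) -⊛ ψ))
    × ((L : List SizeLit) (X : List PVar) → Satisfiable (sizeConj L) →
    ⊢ (sizeConj L & ⋀ (map (λ x → ~ alloc x) X)) -⊛ ⊤')
lemma6p3 =
    septract-⊥ˡ
  , septract-⊥ʳ
  , ∗-wand-elim
  , septract-monoˡ
  , septract-monoʳ
  , septract-∗
  , septract-∨ˡ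
  , septract-∨ʳ
  , septract-&-wand
  , (λ φ ψ x y → septract-pure (Pure-≐ x y) φ ψ)
  , (λ φ ψ x y → septract-pure (Pure-~ (Pure-≐ x y)) φ ψ)
  , septract-sizeConj
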